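{- Let $L$ be a finite field of characteristic $p$ and order $q$. The exponent $s=3$ is nice over $L$ if and only if $q\not\equiv 1\pmod 3$. Moreover, in that case the differential multiplicities $N(1,v)$, $v\in L$, are as follows: if $p=2$, the value $0$ occurs for $q/2$ values of $v$ and the value $2$ for $q/2$ values of $v$; if $p=3$, the value $0$ occurs for $q-1$ values of $v$ and the value $q$ for one value of $v$; if $p>3$, the value $0$ occurs for $(q-1)/2$ values of $v$, the value $1$ for one value of $v$, and the value $2$ for $(q-1)/2$ values of $v$.
   Context: An integer $s\ge 1$ is an invertible exponent over $L$ if $\gcd(s,q-1)=1$. For an invertible exponent $s$ and $v\in L$, $N(1,v)$ denotes the number of pairs $(x,y)\in L^2$ with $x+y=1$ and $x^s+y^s=v$ (the differential multiplicities of $s$). An invertible exponent $s$ is called nice over $L$ if $N(1,v)$ takes at most $3$ distinct values as $v$ runs through $L$. -}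

module Defs where

open import Data.Nat as ℕ using (ℕ; zero; suc; _≤_; _<_)
open import Data.Nat.GCD using (gcd)
open import Data.Fin using (Fin)
open import Data.Fin.Properties using () renaming (_≟_ to _≟F_)
open import Data.List using (List; length; filter; map; allFin; deduplicate; cartesianProduct)
open import Data.Product using (_×_; _,_; ∃)
open import Relation.Nullary using (¬_; _×-dec_)
open import Relation.Binary.PropositionalEquality using (_≡_; _≢_)
open import Algebra.Structures using (IsCommutativeRing)

-- A finite field of order q, presented (up to isomorphism) with carrier Fin q
-- and propositional equality.
record FiniteField (q : ℕ) : Set where
  infixl 6 _+_
  infixl 7 _*_
  field
    _+_ _*_ : Fin q → Fin q → Fin q
    -_      : Fin q → Fin q
    0# 1#   : Fin q
    isCommutativeRing : IsCommutativeRing _≡_ _+_ _*_ -_ 0# 1#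
    0≢1     : 0# ≢ 1#
    inverse : ∀ x → x ≢ 0# → ∃ λ y → x * y ≡ 1#

  _^_ : Fin q → ℕ → Fin q
  x ^ zero  = 1#
  x ^ suc n = x * (x ^ n)

  _×1 : ℕ → Fin q
  zero ×1  = 0#
  suc n ×1 = 1# + (n ×1)

open FiniteField public

IsCharacteristic : ∀ {q} → FiniteField q → ℕ → Set
IsCharacteristic L p =
  1 ≤ p × (_×1 L p ≡ 0# L) × (∀ m → 1 ≤ m → m < p → _×1 L m ≢ 0# L)

InvertibleExponent : ℕ → ℕ → Set
InvertibleExponent q s = 1 ≤ s × gcd s (q ℕ.∸ 1) ≡ 1

N1 : ∀ {q} → FiniteField q → ℕ → Fin q → ℕ
N1 {q} L s v = length (filter P? (cartesianProduct (allFin q) (allFin q)))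
  where
    P? = λ (xy : Fin q × Fin q) →
      let x = Data.Product.proj₁ xy ; y = Data.Product.proj₂ xy in
      (_≟F_ (_+_ L x y) (1# L)) ×-dec (_≟F_ (_+_ L (_^_ L x s) (_^_ L y s)) v)

Multiplicity : ∀ {q} → FiniteField q → ℕ → ℕ → ℕ
Multiplicity {q} L s k = length (filter (λ v → N1 L s v ℕ.≟ k) (allFin q))

MultiplicityValues : ∀ {q} → FiniteField q → ℕ → List ℕ
MultiplicityValues {q} L s = deduplicate ℕ._≟_ (map (N1 L s) (allFin q))

Nice : ∀ {q} → FiniteField q → ℕ → Set
Nice {q} L s = InvertibleExponent q s × length (MultiplicityValues L s) ≤ 3

module Submission where

-- On the line x + y = 1 a pair is determined by x, so N(1,v) is the size of
-- the fibre over v of g x = x³ + (1 - x)³.  Two polynomial identities govern g: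
-- g x = 1 - 3x(1 - x), and g x - g y = 3 (x - y)(x + y - 1).  Hence in
-- characteristic 3 the map g is constantly 1 (one fibre of size q, the rest
-- empty), while otherwise the fibre through x₀ is {x₀ , 1 - x₀}: it has two
-- points, or one when x₀ is self-paired (2x₀ = 1), which happens for no x₀ in
-- characteristic 2 and for x₀ = 1/2 alone in characteristic > 3.  Since the
-- fibre sizes sum to q, counting how many fibres have each size yields the
-- multiplicities, and in every case at most three sizes occur.  Finally
-- gcd(3, q - 1) = 1 iff 3 ∤ q - 1 iff q ≢ 1 (mod 3), which settles niceness.

open import Defs using (FiniteField; module FiniteField; IsCharacteristic; InvertibleExponent;
  N1; Multiplicity; MultiplicityValues; Nice)
open import Data.Nat as ℕ using (ℕ; zero; suc; _/_; _%_; _∸_; _>_; _≤_; s≤s; z≤n)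
import Data.Nat.Properties as ℕP
open import Data.Fin using (Fin)
open import Data.Fin.Properties using (_≟_; any?; ¬Fin0)
open import Data.Product using (_×_; _,_; ∃; proj₁; proj₂) renaming (map to map-×)
open import Data.Sum using (_⊎_; inj₁; inj₂; [_,_]′)
open import Function using (_∘_; _⇔_; mk⇔; Equivalence)
open import Relation.Nullary using (¬_; Dec; yes; no; contradiction; _×-dec_)
open import Relation.Unary using (Pred; Decidable)
open import Relation.Binary.PropositionalEquality
  using (_≡_; _≢_; refl; sym; trans; cong; cong₂; subst; module ≡-Reasoning)
open import Algebra.Bundles using (CommutativeRing)
open import Algebra.Properties.Semiring.Sum ℕP.+-*-semiring
  using (sum-syntax; sum-cong-≗; ∑-distrib-+; ∑-comm; *-distribˡ-sum; *-distribʳ-sum)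

open Equivalence using (to; from)

-- Every commutative ring receives the canonical map ℤ → R, a ring
-- homomorphism.  Using it as the coefficient map instantiates the standard
-- library's ring solver with integer constants (con (+ n) denotes n · 1),
-- so identities such as (1 - x)³ = 1 - 3x + 3x² - x³ hold by normalisation.
module IntegerRingSolver {c ℓ} (R : CommutativeRing c ℓ) where

  open import Data.Integer as ℤ using (ℤ; +_; -[1+_]; _⊖_)
  import Data.Integer.Properties as ℤP
  open import Data.Maybe using (Maybe; just; nothing)
  import Algebra.Solver.Ring.AlmostCommutativeRing as ACR
  import Algebra.Solver.Ring as RingSolver

  open CommutativeRing R renaming (sym to ≈-sym; trans to ≈-trans; refl to ≈-refl; reflexive to ≈-reflexive)
  open import Algebra.Properties.Ring ring using (-‿distribˡ-*; -‿distribʳ-*; -‿involutive; -0#≈0#)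
  open import Algebra.Properties.AbelianGroup +-abelianGroup using (⁻¹-∙-comm)
  open import Algebra.Properties.CommutativeSemigroup +-commutativeSemigroup using (interchange)
  open import Algebra.Properties.Semiring.Mult.TCOptimised semiring using (×-homo-+; ×1-homo-*) renaming (_×_ to _·_)
  open import Relation.Binary.Reasoning.Setoid setoid

  ⟦_⟧ℤ : ℤ → Carrier
  ⟦ + n ⟧ℤ      = n · 1#
  ⟦ -[1+ n ] ⟧ℤ = - (suc n · 1#)

  ⟦⟧-neg : ∀ i → ⟦ ℤ.- i ⟧ℤ ≈ - ⟦ i ⟧ℤ
  ⟦⟧-neg (+ zero)  = ≈-sym -0#≈0#
  ⟦⟧-neg (+ suc n) = ≈-refl
  ⟦⟧-neg -[1+ n ]  = ≈-sym (-‿involutive _)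

  ⟦⟧-⊖ : ∀ m n → ⟦ m ⊖ n ⟧ℤ ≈ m · 1# - n · 1#
  ⟦⟧-⊖ zero    zero    = ≈-sym (≈-trans (+-congˡ -0#≈0#) (+-identityʳ 0#))
  ⟦⟧-⊖ zero    (suc n) = ≈-sym (+-identityˡ _)
  ⟦⟧-⊖ (suc m) zero    = ≈-sym (≈-trans (+-congˡ -0#≈0#) (+-identityʳ _))
  ⟦⟧-⊖ (suc m) (suc n) = begin
    ⟦ suc m ⊖ suc n ⟧ℤ                ≡⟨ cong ⟦_⟧ℤ (ℤP.[1+m]⊖[1+n]≡m⊖n m n) ⟩
    ⟦ m ⊖ n ⟧ℤ                        ≈⟨ ⟦⟧-⊖ m n ⟩
    m · 1# - n · 1#                   ≈⟨ +-identityˡ _ ⟨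
    0# + (m · 1# - n · 1#)            ≈⟨ +-congʳ (-‿inverseʳ 1#) ⟨
    (1# - 1#) + (m · 1# - n · 1#)     ≈⟨ interchange 1# (- 1#) (m · 1#) (- (n · 1#)) ⟩
    (1# + m · 1#) + (- 1# - n · 1#)   ≈⟨ +-congˡ (⁻¹-∙-comm 1# (n · 1#)) ⟩
    (1# + m · 1#) - (1# + n · 1#)     ≈⟨ +-cong (×-homo-+ 1# 1 m) (-‿cong (×-homo-+ 1# 1 n)) ⟨
    suc m · 1# - suc n · 1#           ∎

  ⟦⟧-+ : ∀ i j → ⟦ i ℤ.+ j ⟧ℤ ≈ ⟦ i ⟧ℤ + ⟦ j ⟧ℤ
  ⟦⟧-+ (+ m)    (+ n)    = ×-homo-+ 1# m n
  ⟦⟧-+ (+ m)    -[1+ n ] = ⟦⟧-⊖ m (suc n)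
  ⟦⟧-+ -[1+ m ] (+ n)    = ≈-trans (⟦⟧-⊖ n (suc m)) (+-comm _ _)
  ⟦⟧-+ -[1+ m ] -[1+ n ] = begin
    - (suc (suc (m ℕ.+ n)) · 1#)          ≡⟨ cong (λ k → - (suc k · 1#)) (ℕP.+-suc m n) ⟨
    - ((suc m ℕ.+ suc n) · 1#)            ≈⟨ -‿cong (×-homo-+ 1# (suc m) (suc n)) ⟩
    - (suc m · 1# + suc n · 1#)           ≈⟨ ⁻¹-∙-comm _ _ ⟨
    - (suc m · 1#) + - (suc n · 1#)       ∎

  ⟦⟧-*-pos : ∀ m j → ⟦ + m ℤ.* j ⟧ℤ ≈ ⟦ + m ⟧ℤ * ⟦ j ⟧ℤ
  ⟦⟧-*-pos m (+ n)    = ≈-trans (≈-reflexive (cong ⟦_⟧ℤ (sym (ℤP.pos-* m n)))) (×1-homo-* m n)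
  ⟦⟧-*-pos m -[1+ n ] = begin
    ⟦ + m ℤ.* -[1+ n ] ⟧ℤ               ≡⟨ cong ⟦_⟧ℤ (ℤP.neg-distribʳ-* (+ m) (+ suc n)) ⟨
    ⟦ ℤ.- (+ m ℤ.* + suc n) ⟧ℤ          ≈⟨ ⟦⟧-neg (+ m ℤ.* + suc n) ⟩
    - ⟦ + m ℤ.* + suc n ⟧ℤ              ≈⟨ -‿cong (⟦⟧-*-pos m (+ suc n)) ⟩
    - (⟦ + m ⟧ℤ * ⟦ + suc n ⟧ℤ)         ≈⟨ -‿distribʳ-* _ _ ⟩
    ⟦ + m ⟧ℤ * ⟦ -[1+ n ] ⟧ℤ             ∎

  ⟦⟧-* : ∀ i j → ⟦ i ℤ.* j ⟧ℤ ≈ ⟦ i ⟧ℤ * ⟦ j ⟧ℤ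
  ⟦⟧-* (+ m)    j = ⟦⟧-*-pos m j
  ⟦⟧-* -[1+ m ] j = begin
    ⟦ -[1+ m ] ℤ.* j ⟧ℤ                 ≡⟨ cong ⟦_⟧ℤ (ℤP.neg-distribˡ-* (+ suc m) j) ⟨
    ⟦ ℤ.- (+ suc m ℤ.* j) ⟧ℤ            ≈⟨ ⟦⟧-neg (+ suc m ℤ.* j) ⟩
    - ⟦ + suc m ℤ.* j ⟧ℤ                ≈⟨ -‿cong (⟦⟧-*-pos (suc m) j) ⟩
    - (⟦ + suc m ⟧ℤ * ⟦ j ⟧ℤ)           ≈⟨ -‿distribˡ-* _ _ ⟩
    ⟦ -[1+ m ] ⟧ℤ * ⟦ j ⟧ℤ               ∎

  homomorphism : ℤ.+-*-rawRing ACR.-Raw-AlmostCommutative⟶ ACR.fromCommutativeRing R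
  homomorphism = record
    { ⟦_⟧ = ⟦_⟧ℤ ; +-homo = ⟦⟧-+ ; *-homo = ⟦⟧-* ; -‿homo = ⟦⟧-neg
    ; 0-homo = ≈-refl ; 1-homo = ≈-refl }

  -- equal integers have equal images: all the solver needs to know about
  -- equality of coefficients
  coefficients≟ : ∀ i j → Maybe (⟦ i ⟧ℤ ≈ ⟦ j ⟧ℤ)
  coefficients≟ i j with i ℤ.≟ j
  ... | yes refl = just ≈-refl
  ... | no _     = nothing

  open RingSolver ℤ.+-*-rawRing (ACR.fromCommutativeRing R) homomorphism coefficients≟ public

-- Counting with finite sums ∑[ x < n ] over Fin n of Iverson brackets.
module FiniteSums where

  open import Data.Nat using (_+_; _*_)
  open import Data.Fin using (zero; suc)
  open import Data.Fin.Properties using (suc-injective)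
  open import Data.List using (length; filter; map; tabulate; allFin; cartesianProduct; _++_)
  import Data.List.Properties as ListP
  open ≡-Reasoning

  [_] : ∀ {p} {P : Set p} → Dec P → ℕ
  [ yes _ ] = 1
  [ no _ ]  = 0

  []-yes : ∀ {p} {P : Set p} (d : Dec P) → P → [ d ] ≡ 1
  []-yes (yes _) _  = refl
  []-yes (no ¬p) p  = contradiction p ¬p

  []-no : ∀ {p} {P : Set p} (d : Dec P) → ¬ P → [ d ] ≡ 0
  []-no (yes p) ¬p = contradiction p ¬p
  []-no (no _)  _  = refl

  []-cong : ∀ {p q} {P : Set p} {Q : Set q} → P ⇔ Q → (d : Dec P) (e : Dec Q) → [ d ] ≡ [ e ]
  []-cong P⇔Q (yes p) e = sym ([]-yes e (to P⇔Q p))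
  []-cong P⇔Q (no ¬p) e = sym ([]-no e (¬p ∘ from P⇔Q))

  []-× : ∀ {p q} {P : Set p} {Q : Set q} (d : Dec P) (e : Dec Q) → [ d ×-dec e ] ≡ [ d ] * [ e ]
  []-× (yes _) (yes _) = refl
  []-× (yes _) (no _)  = refl
  []-× (no _)  _       = refl

  ∑-cong : ∀ n {f g : Fin n → ℕ} → (∀ x → f x ≡ g x) → ∑[ x < n ] f x ≡ ∑[ x < n ] g x
  ∑-cong n = sum-cong-≗

  ∑-const : ∀ n k → ∑[ i < n ] k ≡ n * k
  ∑-const zero    k = refl
  ∑-const (suc n) k = cong (k +_) (∑-const n k)

  ∑-delta : ∀ {n} (c : Fin n) → ∑[ x < n ] [ x ≟ c ] ≡ 1
  ∑-delta {suc n} zero = cong suc (begin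
    ∑[ x < n ] [ suc x ≟ zero ]  ≡⟨ ∑-cong n (λ x → []-no (suc x ≟ zero) λ ()) ⟩
    ∑[ x < n ] 0                 ≡⟨ ∑-const n 0 ⟩
    n * 0                        ≡⟨ ℕP.*-zeroʳ n ⟩
    0                            ∎)
  ∑-delta {suc n} (suc c) = begin
    [ zero ≟ suc c ] + ∑[ x < n ] [ suc x ≟ suc c ]
      ≡⟨ cong₂ _+_ ([]-no (zero ≟ suc c) λ ())
                   (∑-cong n λ x → []-cong (mk⇔ suc-injective (cong suc)) (suc x ≟ suc c) (x ≟ c)) ⟩
    ∑[ x < n ] [ x ≟ c ]
      ≡⟨ ∑-delta c ⟩
    1 ∎

  module _ {n p} {P : Pred (Fin n) p} (P? : Decidable P) where

    count-all : (∀ x → P x) → ∑[ x < n ] [ P? x ] ≡ n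
    count-all P = trans (∑-cong n λ x → []-yes (P? x) (P x)) (trans (∑-const n 1) (ℕP.*-identityʳ n))

    count-empty : (∀ x → ¬ P x) → ∑[ x < n ] [ P? x ] ≡ 0
    count-empty ¬P = trans (∑-cong n λ x → []-no (P? x) (¬P x)) (trans (∑-const n 0) (ℕP.*-zeroʳ n))

    count-singleton : ∀ {c} → (∀ x → P x ⇔ x ≡ c) → ∑[ x < n ] [ P? x ] ≡ 1
    count-singleton {c} P⇔ = trans (∑-cong n λ x → []-cong (P⇔ x) (P? x) (x ≟ c)) (∑-delta c)

    count-pair : ∀ {a b} → a ≢ b → (∀ x → P x ⇔ (x ≡ a ⊎ x ≡ b)) → ∑[ x < n ] [ P? x ] ≡ 2
    count-pair {a} {b} a≢b P⇔ = begin
      ∑[ x < n ] [ P? x ]                          ≡⟨ ∑-cong n split ⟩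
      ∑[ x < n ] ([ x ≟ a ] + [ x ≟ b ])           ≡⟨ ∑-distrib-+ (λ x → [ x ≟ a ]) (λ x → [ x ≟ b ]) ⟩
      ∑[ x < n ] [ x ≟ a ] + ∑[ x < n ] [ x ≟ b ]  ≡⟨ cong₂ _+_ (∑-delta a) (∑-delta b) ⟩
      2                                            ∎
      where
      split : ∀ x → [ P? x ] ≡ [ x ≟ a ] + [ x ≟ b ]
      split x with x ≟ a | x ≟ b
      ... | yes x≡a | yes x≡b = contradiction (trans (sym x≡a) x≡b) a≢b
      ... | yes x≡a | no _    = []-yes (P? x) (from (P⇔ x) (inj₁ x≡a))
      ... | no _    | yes x≡b = []-yes (P? x) (from (P⇔ x) (inj₂ x≡b))
      ... | no x≢a  | no x≢b  = []-no (P? x) λ Px → [ x≢a , x≢b ]′ (to (P⇔ x) Px)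

  count-tabulate : ∀ {a p} {A : Set a} {P : Pred A p} (P? : Decidable P) {n} (f : Fin n → A) →
                   length (filter P? (tabulate f)) ≡ ∑[ i < n ] [ P? (f i) ]
  count-tabulate P? {zero}  f = refl
  count-tabulate P? {suc n} f with P? (f zero)
  ... | yes _ = cong suc (count-tabulate P? (f ∘ suc))
  ... | no _  = count-tabulate P? (f ∘ suc)

  count-pairs : ∀ {p m n} {P : Pred (Fin m × Fin n) p} (P? : Decidable P) →
                length (filter P? (cartesianProduct (allFin m) (allFin n))) ≡ ∑[ x < m ] ∑[ y < n ] [ P? (x , y) ]
  count-pairs {m = m} {n} P? = rows (λ x → x)
    where
    row : (x : Fin m) → length (filter P? (map (x ,_) (allFin n))) ≡ ∑[ y < n ] [ P? (x , y) ]
    row x = trans (cong (length ∘ filter P?) (ListP.map-tabulate (λ y → y) (x ,_))) (count-tabulate P? (x ,_))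

    rows : ∀ {k} (f : Fin k → Fin m) →
           length (filter P? (cartesianProduct (tabulate f) (allFin n))) ≡ ∑[ i < k ] ∑[ y < n ] [ P? (f i , y) ]
    rows {zero}  f = refl
    rows {suc k} f = begin
      length (filter P? (map (f zero ,_) (allFin n) ++ rest))
        ≡⟨ cong length (ListP.filter-++ P? (map (f zero ,_) (allFin n)) rest) ⟩
      length (filter P? (map (f zero ,_) (allFin n)) ++ filter P? rest)
        ≡⟨ ListP.length-++ (filter P? (map (f zero ,_) (allFin n))) ⟩
      length (filter P? (map (f zero ,_) (allFin n))) + length (filter P? rest)
        ≡⟨ cong₂ _+_ (row (f zero)) (rows (f ∘ suc)) ⟩
      ∑[ y < n ] [ P? (f zero , y) ] + ∑[ i < k ] ∑[ y < n ] [ P? (f (suc i) , y) ] ∎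
      where
      rest = cartesianProduct (tabulate (f ∘ suc)) (allFin n)

  ∑-fibres : ∀ {m n} (f : Fin m → Fin n) → ∑[ v < n ] ∑[ x < m ] [ f x ≟ v ] ≡ m
  ∑-fibres {m} {n} f = begin
    ∑[ v < n ] ∑[ x < m ] [ f x ≟ v ]   ≡⟨ ∑-comm (λ v x → [ f x ≟ v ]) ⟩
    ∑[ x < m ] ∑[ v < n ] [ f x ≟ v ]   ≡⟨ ∑-cong m (λ x → count-singleton (f x ≟_) (λ v → mk⇔ sym sym)) ⟩
    ∑[ x < m ] 1                        ≡⟨ ∑-const m 1 ⟩
    m * 1                               ≡⟨ ℕP.*-identityʳ m ⟩
    m                                   ∎

  occurrences : ∀ {n} → (Fin n → ℕ) → ℕ → ℕ
  occurrences {n} h k = ∑[ v < n ] [ h v ℕ.≟ k ]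

  module _ {n r} (h : Fin n → ℕ) (ks : Fin r → ℕ)
           (once : ∀ v → ∑[ i < r ] [ h v ℕ.≟ ks i ] ≡ 1) where

    occurrences-total : ∑[ i < r ] occurrences h (ks i) ≡ n
    occurrences-total = begin
      ∑[ i < r ] ∑[ v < n ] [ h v ℕ.≟ ks i ]   ≡⟨ ∑-comm (λ i v → [ h v ℕ.≟ ks i ]) ⟩
      ∑[ v < n ] ∑[ i < r ] [ h v ℕ.≟ ks i ]   ≡⟨ ∑-cong n once ⟩
      ∑[ v < n ] 1                             ≡⟨ ∑-const n 1 ⟩
      n * 1                                    ≡⟨ ℕP.*-identityʳ n ⟩
      n                                        ∎

    occurrences-weighted : ∑[ i < r ] (ks i * occurrences h (ks i)) ≡ ∑[ v < n ] h v
    occurrences-weighted = begin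
      ∑[ i < r ] (ks i * ∑[ v < n ] [ h v ℕ.≟ ks i ])
        ≡⟨ ∑-cong r (λ i → *-distribˡ-sum (ks i) (λ v → [ h v ℕ.≟ ks i ])) ⟩
      ∑[ i < r ] ∑[ v < n ] (ks i * [ h v ℕ.≟ ks i ])
        ≡⟨ ∑-comm (λ i v → ks i * [ h v ℕ.≟ ks i ]) ⟩
      ∑[ v < n ] ∑[ i < r ] (ks i * [ h v ℕ.≟ ks i ])
        ≡⟨ ∑-cong n (λ v → ∑-cong r (λ i → weight (h v) (ks i))) ⟩
      ∑[ v < n ] ∑[ i < r ] (h v * [ h v ℕ.≟ ks i ])
        ≡⟨ ∑-cong n (λ v → *-distribˡ-sum (h v) (λ i → [ h v ℕ.≟ ks i ])) ⟨
      ∑[ v < n ] (h v * ∑[ i < r ] [ h v ℕ.≟ ks i ])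
        ≡⟨ ∑-cong n (λ v → trans (cong (h v *_) (once v)) (ℕP.*-identityʳ (h v))) ⟩
      ∑[ v < n ] h v ∎
      where
      -- a term k · [a = k] only survives when k = a
      weight : ∀ a k → k * [ a ℕ.≟ k ] ≡ a * [ a ℕ.≟ k ]
      weight a k with a ℕ.≟ k
      ... | yes refl = refl
      ... | no _     = trans (ℕP.*-zeroʳ k) (sym (ℕP.*-zeroʳ a))

open FiniteSums

module DuplicateFreeLists {a} {A : Set a} where

  open import Data.Fin using (zero; suc)
  open import Data.Fin.Properties using (injective⇒≤)
  open import Data.List using (List; length; lookup)
  open import Data.List.Membership.Propositional using (_∈_)
  open import Data.List.Membership.Propositional.Properties using (∈-lookup)
  open import Data.List.Relation.Unary.All as All using (All)
  open import Data.List.Relation.Unary.Any using (index)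
  open import Data.List.Relation.Unary.Any.Properties using (lookup-index)
  open import Data.List.Relation.Unary.AllPairs using (_∷_)
  open import Data.List.Relation.Unary.Unique.Propositional using (Unique)
  open ≡-Reasoning

  unique-lookup-injective : ∀ {xs : List A} → Unique xs → ∀ {i j} → lookup xs i ≡ lookup xs j → i ≡ j
  unique-lookup-injective (_ ∷ _)   {zero}  {zero}  _ = refl
  unique-lookup-injective (x∉ ∷ _)  {zero}  {suc j} e = contradiction e (All.lookup x∉ (∈-lookup j))
  unique-lookup-injective (x∉ ∷ _)  {suc i} {zero}  e = contradiction (sym e) (All.lookup x∉ (∈-lookup i))
  unique-lookup-injective (_ ∷ xs!) {suc i} {suc j} e = cong suc (unique-lookup-injective xs! e)

  -- sending each entry to its position in zs is injective
  unique-length-≤ : ∀ {ys zs : List A} → Unique ys → All (_∈ zs) ys → length ys ≤ length zs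
  unique-length-≤ {ys} {zs} ys! ys⊆zs = injective⇒≤ position-injective
    where
    position : Fin (length ys) → Fin (length zs)
    position i = index (All.lookup ys⊆zs (∈-lookup i))

    position-injective : ∀ {i j} → position i ≡ position j → i ≡ j
    position-injective {i} {j} e = unique-lookup-injective ys! (begin
      lookup ys i              ≡⟨ lookup-index (All.lookup ys⊆zs (∈-lookup i)) ⟩
      lookup zs (position i)   ≡⟨ cong (lookup zs) e ⟩
      lookup zs (position j)   ≡⟨ lookup-index (All.lookup ys⊆zs (∈-lookup j)) ⟨
      lookup ys j              ∎)

open DuplicateFreeLists

-- Arithmetic: solving the counting equations, and invertibility of 3.
module Arithmetic where

  open import Data.Nat using (_+_; _*_)
  open import Data.Nat.DivMod using (m*n/n≡m; m≡m%n+[m/n]*n; [m+kn]%n≡m%n)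
  open import Data.Nat.Divisibility using (_∣_; divides; ∣1⇒≡1; ∣-refl)
  open import Data.Nat.GCD using (gcd; gcd-greatest)
  open import Data.Nat.Coprimality using (coprime⇒gcd≡1)
  open import Data.Nat.Primality using (Prime; prime?; prime⇒irreducible; ¬prime[1])
  open import Relation.Nullary.Decidable using (from-yes)
  open ≡-Reasoning

  halves : ∀ {a b n} → a + b ≡ n → 2 * b ≡ n → a ≡ n / 2 × b ≡ n / 2
  halves {a} {b} {n} a+b≡n 2b≡n = trans a≡b b≡n/2 , b≡n/2
    where
    b≡n/2 : b ≡ n / 2
    b≡n/2 = begin
      b          ≡⟨ m*n/n≡m b 2 ⟨
      b * 2 / 2  ≡⟨ cong (_/ 2) (trans (ℕP.*-comm b 2) 2b≡n) ⟩
      n / 2      ∎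
    a≡b : a ≡ b
    a≡b = ℕP.+-cancelʳ-≡ b a b (trans a+b≡n (trans (sym 2b≡n) (cong (b +_) (ℕP.+-identityʳ b))))

  odd-halves : ∀ {a b n} → a + (1 + b) ≡ n → 1 + 2 * b ≡ n → a ≡ (n ∸ 1) / 2 × b ≡ (n ∸ 1) / 2
  odd-halves {a} {b} a+1+b≡n 1+2b≡n = halves
    (cong (_∸ 1) (trans (sym (ℕP.+-suc a b)) a+1+b≡n))
    (cong (_∸ 1) 1+2b≡n)

  all-but-one : ∀ {a b n} → n ≢ 0 → a + b ≡ n → n * b ≡ n → a ≡ n ∸ 1 × b ≡ 1
  all-but-one {a} {b} {n} n≢0 a+b≡n nb≡n = a≡n∸1 , b≡1
    where
    b≡1 : b ≡ 1
    b≡1 = ℕP.*-cancelˡ-≡ b 1 n {{ℕ.≢-nonZero n≢0}} (trans nb≡n (sym (ℕP.*-identityʳ n)))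
    a≡n∸1 : a ≡ n ∸ 1
    a≡n∸1 = begin
      a            ≡⟨ ℕP.m+n∸n≡m a 1 ⟨
      a + 1 ∸ 1    ≡⟨ cong (λ k → a + k ∸ 1) b≡1 ⟨
      a + b ∸ 1    ≡⟨ cong (_∸ 1) a+b≡n ⟩
      n ∸ 1        ∎

  prime-gcd≡1⇔∤ : ∀ {p m} → Prime p → gcd p m ≡ 1 ⇔ (¬ p ∣ m)
  prime-gcd≡1⇔∤ {p} {m} p-prime = mk⇔
    (λ gcd≡1 p∣m → ¬prime[1] (subst Prime (∣1⇒≡1 (subst (p ∣_) gcd≡1 (gcd-greatest ∣-refl p∣m)))
                                           p-prime))
    (λ p∤m → coprime⇒gcd≡1 λ (d∣p , d∣m) → common-divisor d∣p d∣m p∤m)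
    where
    common-divisor : ∀ {d} → d ∣ p → d ∣ m → ¬ p ∣ m → d ≡ 1
    common-divisor d∣p d∣m p∤m with prime⇒irreducible p-prime d∣p
    ... | inj₁ d≡1  = d≡1
    ... | inj₂ refl = contradiction d∣m p∤m

  ∣⇔suc-rem≡1 : ∀ {k m} → suc (suc k) ∣ m ⇔ suc m % suc (suc k) ≡ 1
  ∣⇔suc-rem≡1 {k} {m} = mk⇔ rem≡1 divisible
    where
    n = suc (suc k)
    rem≡1 : n ∣ m → suc m % n ≡ 1
    rem≡1 (divides c m≡c*n) = trans (cong (λ t → suc t % n) m≡c*n) ([m+kn]%n≡m%n 1 c n)
    divisible : suc m % n ≡ 1 → n ∣ m
    divisible suc-m%n≡1 = divides (suc m / n)
      (ℕP.suc-injective (trans (m≡m%n+[m/n]*n (suc m) n) (cong (_+ (suc m / n) * n) suc-m%n≡1)))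

  invertible-3⇔ : ∀ m → InvertibleExponent (suc m) 3 ⇔ (¬ suc m % 3 ≡ 1)
  invertible-3⇔ m = mk⇔
    (λ (_ , gcd≡1) → to 3-coprime gcd≡1 ∘ from 3-divides)
    (λ rem≢1 → s≤s z≤n , from 3-coprime (rem≢1 ∘ to 3-divides))
    where
    3-coprime : gcd 3 m ≡ 1 ⇔ (¬ 3 ∣ m)
    3-coprime = prime-gcd≡1⇔∤ (from-yes (prime? 3))
    3-divides : 3 ∣ m ⇔ suc m % 3 ≡ 1
    3-divides = ∣⇔suc-rem≡1

open Arithmetic

-- The cube sum over a finite field L and the sizes of its fibres.
module CubeSum {q : ℕ} (L : FiniteField q) where

  import Data.Integer as ℤ
  open import Data.List using (List; length; allFin; _∷_; []) renaming (map to map-list)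
  open import Data.List.Membership.Propositional using (_∈_)
  open import Data.List.Relation.Unary.Any using (here; there)
  open import Data.List.Relation.Unary.All.Properties using (deduplicate⁺; map⁺; tabulate⁺)
  open import Data.List.Relation.Unary.Unique.DecPropositional.Properties ℕ._≟_ using (deduplicate-!)
  open import Data.Vec.Functional using () renaming (_∷_ to _∷ᵛ_; [] to []ᵛ)
  open FiniteField L using (_+_; _*_; -_; 0#; 1#; _^_; _×1; isCommutativeRing; 0≢1; inverse)
  open ≡-Reasoning

  commutativeRing : CommutativeRing _ _
  commutativeRing = record { isCommutativeRing = isCommutativeRing }

  open IntegerRingSolver commutativeRing using (Polynomial; solve; _:=_; _:+_; _:-_; _:*_; _:^_; con)

  infixl 6 _-_
  _-_ : Fin q → Fin q → Fin q
  x - y = x + - y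

  two three : Fin q
  two   = 1# + 1#
  three = 1# + 1# + 1#

  c0 c1 c2 c3 : ∀ {n} → Polynomial n
  c0 = con (ℤ.+ 0)
  c1 = con (ℤ.+ 1)
  c2 = con (ℤ.+ 2)
  c3 = con (ℤ.+ 3)

  2×1≡two : 2 ×1 ≡ two
  2×1≡two = solve 0 (c1 :+ (c1 :+ c0) := c2) refl

  3×1≡three : 3 ×1 ≡ three
  3×1≡three = solve 0 (c1 :+ (c1 :+ (c1 :+ c0)) := c3) refl

  difference-zero : ∀ {x y} → x - y ≡ 0# → x ≡ y
  difference-zero {x} {y} x-y≡0 = begin
    x             ≡⟨ solve 2 (λ x y → x := (x :- y) :+ y) refl x y ⟩
    (x - y) + y   ≡⟨ cong (_+ y) x-y≡0 ⟩
    0# + y        ≡⟨ solve 1 (λ y → c0 :+ y := y) refl y ⟩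
    y             ∎

  -- a field has no zero divisors: multiply by the inverse of a nonzero factor
  no-zero-divisors : ∀ {x y} → x * y ≡ 0# → x ≡ 0# ⊎ y ≡ 0#
  no-zero-divisors {x} {y} xy≡0 with x ≟ 0#
  ... | yes x≡0 = inj₁ x≡0
  ... | no x≢0  with inverse x x≢0
  ... | x⁻¹ , xx⁻¹≡1 = inj₂ (begin
    y               ≡⟨ solve 1 (λ y → y := c1 :* y) refl y ⟩
    1# * y          ≡⟨ cong (_* y) xx⁻¹≡1 ⟨
    x * x⁻¹ * y     ≡⟨ solve 3 (λ x x⁻¹ y → x :* x⁻¹ :* y := x⁻¹ :* (x :* y)) refl x x⁻¹ y ⟩
    x⁻¹ * (x * y)   ≡⟨ cong (x⁻¹ *_) xy≡0 ⟩
    x⁻¹ * 0#        ≡⟨ solve 1 (λ z → z :* c0 := c0) refl x⁻¹ ⟩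
    0#              ∎)

  on-line : ∀ {x y} → x + y ≡ 1# ⇔ y ≡ 1# - x
  on-line {x} {y} = mk⇔ solve-for-y on-the-line
    where
    solve-for-y : x + y ≡ 1# → y ≡ 1# - x
    solve-for-y x+y≡1 = begin
      y             ≡⟨ solve 2 (λ x y → y := (x :+ y) :- x) refl x y ⟩
      (x + y) - x   ≡⟨ cong (_- x) x+y≡1 ⟩
      1# - x        ∎
    on-the-line : y ≡ 1# - x → x + y ≡ 1#
    on-the-line refl = solve 1 (λ x → x :+ (c1 :- x) := c1) refl x

  g : Fin q → Fin q
  g x = x ^ 3 + (1# - x) ^ 3

  g-closed-form : ∀ x → g x ≡ 1# - three * (x * (1# - x))
  g-closed-form = solve 1 (λ x → x :^ 3 :+ (c1 :- x) :^ 3 := c1 :- c3 :* (x :* (c1 :- x))) refl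

  g-symmetric : ∀ x → g (1# - x) ≡ g x
  g-symmetric = solve 1 (λ x → (c1 :- x) :^ 3 :+ (c1 :- (c1 :- x)) :^ 3 := x :^ 3 :+ (c1 :- x) :^ 3) refl

  g-difference : ∀ x y → g x - g y ≡ three * ((x - y) * (x + y - 1#))
  g-difference = solve 2 (λ x y → (x :^ 3 :+ (c1 :- x) :^ 3) :- (y :^ 3 :+ (c1 :- y) :^ 3)
                                  := c3 :* ((x :- y) :* (x :+ y :- c1))) refl

  g-pairing : three ≢ 0# → ∀ {x y} → g x ≡ g y → x ≡ y ⊎ x ≡ 1# - y
  g-pairing 3≢0 {x} {y} gx≡gy with no-zero-divisors factored≡0
    where
    factored≡0 : three * ((x - y) * (x + y - 1#)) ≡ 0#
    factored≡0 = begin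
      three * ((x - y) * (x + y - 1#))   ≡⟨ g-difference x y ⟨
      g x - g y                          ≡⟨ cong (_- g y) gx≡gy ⟩
      g y - g y                          ≡⟨ solve 1 (λ z → z :- z := c0) refl (g y) ⟩
      0#                                 ∎
  ... | inj₁ 3≡0 = contradiction 3≡0 3≢0
  ... | inj₂ product≡0 with no-zero-divisors product≡0
  ...   | inj₁ x-y≡0   = inj₁ (difference-zero x-y≡0)
  ...   | inj₂ x+y-1≡0 = inj₂ (difference-zero
    (trans (solve 2 (λ x y → x :- (c1 :- y) := x :+ y :- c1) refl x y) x+y-1≡0))

  g-char3 : three ≡ 0# → ∀ x → g x ≡ 1#
  g-char3 3≡0 x = begin
    g x                               ≡⟨ g-closed-form x ⟩
    1# - three * (x * (1# - x))       ≡⟨ cong (λ t → 1# - t * (x * (1# - x))) 3≡0 ⟩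
    1# - 0# * (x * (1# - x))          ≡⟨ solve 1 (λ z → c1 :- c0 :* z := c1) refl (x * (1# - x)) ⟩
    1#                                ∎

  self-paired⇒2x≡1 : ∀ {x} → x ≡ 1# - x → two * x ≡ 1#
  self-paired⇒2x≡1 {x} x≡1-x = begin
    two * x         ≡⟨ solve 1 (λ x → c2 :* x := x :+ x) refl x ⟩
    x + x           ≡⟨ cong (x +_) x≡1-x ⟩
    x + (1# - x)    ≡⟨ from on-line refl ⟩
    1#              ∎

  self-paired-char2 : two ≡ 0# → ∀ {x} → x ≢ 1# - x
  self-paired-char2 2≡0 {x} x≡1-x = 0≢1 (begin
    0#          ≡⟨ solve 1 (λ x → c0 := c0 :* x) refl x ⟩
    0# * x      ≡⟨ cong (_* x) 2≡0 ⟨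
    two * x     ≡⟨ self-paired⇒2x≡1 x≡1-x ⟩
    1#          ∎)

  self-paired-unique : two ≢ 0# → ∀ {x y} → x ≡ 1# - x → y ≡ 1# - y → x ≡ y
  self-paired-unique 2≢0 {x} {y} x≡1-x y≡1-y with no-zero-divisors 2[x-y]≡0
    where
    2[x-y]≡0 : two * (x - y) ≡ 0#
    2[x-y]≡0 = begin
      two * (x - y)          ≡⟨ solve 2 (λ x y → c2 :* (x :- y) := c2 :* x :- c2 :* y) refl x y ⟩
      two * x - two * y      ≡⟨ cong₂ _-_ (self-paired⇒2x≡1 x≡1-x) (self-paired⇒2x≡1 y≡1-y) ⟩
      1# - 1#                ≡⟨ solve 0 (c1 :- c1 := c0) refl ⟩
      0#                     ∎
  ... | inj₁ 2≡0   = contradiction 2≡0 2≢0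
  ... | inj₂ x-y≡0 = difference-zero x-y≡0

  self-paired-exists : two ≢ 0# → ∃ λ h → h ≡ 1# - h
  self-paired-exists 2≢0 with inverse two 2≢0
  ... | h , 2h≡1 = h , (begin
    h                 ≡⟨ solve 1 (λ h → h := c2 :* h :- h) refl h ⟩
    two * h - h       ≡⟨ cong (_- h) 2h≡1 ⟩
    1# - h            ∎)

  N : Fin q → ℕ
  N v = ∑[ x < q ] [ g x ≟ v ]

  -- a pair on the line x + y = 1 is determined by its first coordinate
  N1≡N : ∀ v → N1 L 3 v ≡ N v
  N1≡N v = trans (count-pairs (λ xy → (proj₁ xy + proj₂ xy ≟ 1#) ×-dec (proj₁ xy ^ 3 + proj₂ xy ^ 3 ≟ v)))
                 (∑-cong q first-coordinate)
    where
    line-and-level : ∀ x y → (x + y ≡ 1# × x ^ 3 + y ^ 3 ≡ v) ⇔ (y ≡ 1# - x × g x ≡ v)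
    line-and-level x y = mk⇔
      (λ (x+y≡1 , level) → let y≡1-x = to on-line x+y≡1
                           in y≡1-x , trans (cong (λ z → x ^ 3 + z ^ 3) (sym y≡1-x)) level)
      (λ { (refl , level) → from on-line refl , level })

    first-coordinate : ∀ x → ∑[ y < q ] [ (x + y ≟ 1#) ×-dec (x ^ 3 + y ^ 3 ≟ v) ] ≡ [ g x ≟ v ]
    first-coordinate x = begin
      ∑[ y < q ] [ (x + y ≟ 1#) ×-dec (x ^ 3 + y ^ 3 ≟ v) ]
        ≡⟨ ∑-cong q (λ y → trans ([]-cong (line-and-level x y) _ ((y ≟ 1# - x) ×-dec (g x ≟ v)))
                                 ([]-× (y ≟ 1# - x) (g x ≟ v))) ⟩
      ∑[ y < q ] ([ y ≟ 1# - x ] ℕ.* [ g x ≟ v ])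
        ≡⟨ *-distribʳ-sum [ g x ≟ v ] (λ y → [ y ≟ 1# - x ]) ⟨
      ∑[ y < q ] [ y ≟ 1# - x ] ℕ.* [ g x ≟ v ]
        ≡⟨ cong (ℕ._* [ g x ≟ v ]) (∑-delta (1# - x)) ⟩
      1 ℕ.* [ g x ≟ v ]
        ≡⟨ ℕP.*-identityˡ _ ⟩
      [ g x ≟ v ] ∎

  ∑N≡q : ∑[ v < q ] N v ≡ q
  ∑N≡q = ∑-fibres g

  fibre : three ≢ 0# → ∀ {x₀ v} → g x₀ ≡ v → ∀ x → g x ≡ v ⇔ (x ≡ x₀ ⊎ x ≡ 1# - x₀)
  fibre 3≢0 {x₀} refl x = mk⇔ (g-pairing 3≢0) λ
    { (inj₁ refl) → refl
    ; (inj₂ refl) → g-symmetric x₀ }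

  fibre-self-paired : three ≢ 0# → ∀ {x₀ v} → g x₀ ≡ v → x₀ ≡ 1# - x₀ → N v ≡ 1
  fibre-self-paired 3≢0 {x₀} {v} gx₀≡v x₀≡1-x₀ = count-singleton (λ x → g x ≟ v) only-x₀
    where
    only-x₀ : ∀ x → g x ≡ v ⇔ x ≡ x₀
    only-x₀ x = mk⇔ (λ gx≡v → [ (λ e → e) , (λ e → trans e (sym x₀≡1-x₀)) ]′
                                (to (fibre 3≢0 gx₀≡v x) gx≡v))
                    (λ x≡x₀ → from (fibre 3≢0 gx₀≡v x) (inj₁ x≡x₀))

  data FibreSize (v : Fin q) : Set where
    no-preimage   : N v ≡ 0 → FibreSize v
    self-paired   : ∀ x₀ → g x₀ ≡ v → x₀ ≡ 1# - x₀ → N v ≡ 1 → FibreSize v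
    two-preimages : N v ≡ 2 → FibreSize v

  fibre-size : three ≢ 0# → ∀ v → FibreSize v
  fibre-size 3≢0 v with any? (λ x → g x ≟ v)
  ... | no ∄x = no-preimage (count-empty (λ x → g x ≟ v) (λ x gx≡v → ∄x (x , gx≡v)))
  ... | yes (x₀ , gx₀≡v) with x₀ ≟ 1# - x₀
  ...   | yes x₀≡1-x₀ = self-paired x₀ gx₀≡v x₀≡1-x₀ (fibre-self-paired 3≢0 gx₀≡v x₀≡1-x₀)
  ...   | no x₀≢1-x₀  = two-preimages (count-pair (λ x → g x ≟ v) x₀≢1-x₀ (fibre 3≢0 gx₀≡v))

  fibre-sizes : three ≢ 0# → ∀ v → N v ≡ 0 ⊎ N v ≡ 1 ⊎ N v ≡ 2
  fibre-sizes 3≢0 v with fibre-size 3≢0 v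
  ... | no-preimage N≡0       = inj₁ N≡0
  ... | self-paired _ _ _ N≡1 = inj₂ (inj₁ N≡1)
  ... | two-preimages N≡2     = inj₂ (inj₂ N≡2)

  M : ℕ → ℕ
  M = occurrences N

  Multiplicity≡M : ∀ k → Multiplicity L 3 k ≡ M k
  Multiplicity≡M k = trans (count-tabulate (λ v → N1 L 3 v ℕ.≟ k) (λ v → v))
                           (∑-cong q (λ v → cong (λ n → [ n ℕ.≟ k ]) (N1≡N v)))

  -- Characteristic 2: no point is self-paired, so every fibre has 0 or 2 points.
  module Characteristic2 (2≡0 : two ≡ 0#) where

    3≢0 : three ≢ 0#
    3≢0 3≡0 = 0≢1 (begin
      0#          ≡⟨ 3≡0 ⟨
      two + 1#    ≡⟨ cong (_+ 1#) 2≡0 ⟩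
      0# + 1#     ≡⟨ solve 0 (c0 :+ c1 := c1) refl ⟩
      1#          ∎)

    fibre-0-or-2 : ∀ v → N v ≡ 0 ⊎ N v ≡ 2
    fibre-0-or-2 v with fibre-size 3≢0 v
    ... | no-preimage N≡0           = inj₁ N≡0
    ... | self-paired _ _ x₀≡1-x₀ _ = contradiction x₀≡1-x₀ (self-paired-char2 2≡0)
    ... | two-preimages N≡2         = inj₂ N≡2

    once : ∀ {a} → a ≡ 0 ⊎ a ≡ 2 → [ a ℕ.≟ 0 ] ℕ.+ ([ a ℕ.≟ 2 ] ℕ.+ 0) ≡ 1
    once (inj₁ refl) = refl
    once (inj₂ refl) = refl

    multiplicities : M 0 ≡ q / 2 × M 2 ≡ q / 2
    multiplicities = halves
      (trans (cong (M 0 ℕ.+_) (sym (ℕP.+-identityʳ (M 2))))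
             (occurrences-total N (0 ∷ᵛ 2 ∷ᵛ []ᵛ) (once ∘ fibre-0-or-2)))
      (trans (sym (ℕP.+-identityʳ _))
             (trans (occurrences-weighted N (0 ∷ᵛ 2 ∷ᵛ []ᵛ) (once ∘ fibre-0-or-2)) ∑N≡q))

  -- Characteristic 3: g is constant, so one fibre is all of L.
  module Characteristic3 (3≡0 : three ≡ 0#) where

    q≢0 : q ≢ 0
    q≢0 q≡0 = ¬Fin0 (subst Fin q≡0 0#)

    fibre-0-or-q : ∀ v → N v ≡ 0 ⊎ N v ≡ q
    fibre-0-or-q v with 1# ≟ v
    ... | yes 1≡v = inj₂ (count-all (λ x → g x ≟ v) (λ x → trans (g-char3 3≡0 x) 1≡v))
    ... | no 1≢v  = inj₁ (count-empty (λ x → g x ≟ v)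
                           (λ x gx≡v → 1≢v (trans (sym (g-char3 3≡0 x)) gx≡v)))

    once : ∀ {a} → a ≡ 0 ⊎ a ≡ q → [ a ℕ.≟ 0 ] ℕ.+ ([ a ℕ.≟ q ] ℕ.+ 0) ≡ 1
    once (inj₁ refl) = cong (λ k → 1 ℕ.+ (k ℕ.+ 0)) ([]-no (0 ℕ.≟ q) (q≢0 ∘ sym))
    once (inj₂ refl) = cong₂ (λ k l → k ℕ.+ (l ℕ.+ 0)) ([]-no (q ℕ.≟ 0) q≢0) ([]-yes (q ℕ.≟ q) refl)

    multiplicities : M 0 ≡ q ∸ 1 × M q ≡ 1
    multiplicities = all-but-one q≢0
      (trans (cong (M 0 ℕ.+_) (sym (ℕP.+-identityʳ (M q))))
             (occurrences-total N (0 ∷ᵛ q ∷ᵛ []ᵛ) (once ∘ fibre-0-or-q)))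
      (trans (sym (ℕP.+-identityʳ _))
             (trans (occurrences-weighted N (0 ∷ᵛ q ∷ᵛ []ᵛ) (once ∘ fibre-0-or-q)) ∑N≡q))

  -- Characteristic > 3: only the fibre through the self-paired point 1/2 is
  -- a singleton; all others have 0 or 2 points.
  module LargeCharacteristic (2≢0 : two ≢ 0#) (3≢0 : three ≢ 0#) where

    half : Fin q
    half = proj₁ (self-paired-exists 2≢0)

    half-self-paired : half ≡ 1# - half
    half-self-paired = proj₂ (self-paired-exists 2≢0)

    singleton-fibre : ∀ v → N v ≡ 1 ⇔ v ≡ g half
    singleton-fibre v = mk⇔ over-half (λ { refl → fibre-self-paired 3≢0 refl half-self-paired })
      where
      over-half : N v ≡ 1 → v ≡ g half
      over-half N≡1 with fibre-size 3≢0 v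
      ... | no-preimage N≡0                = contradiction (trans (sym N≡0) N≡1) λ ()
      ... | self-paired x₀ gx₀≡v x₀≡1-x₀ _ =
        trans (sym gx₀≡v) (cong g (self-paired-unique 2≢0 x₀≡1-x₀ half-self-paired))
      ... | two-preimages N≡2              = contradiction (trans (sym N≡2) N≡1) λ ()

    M1≡1 : M 1 ≡ 1
    M1≡1 = count-singleton (λ v → N v ℕ.≟ 1) singleton-fibre

    once : ∀ {a} → a ≡ 0 ⊎ a ≡ 1 ⊎ a ≡ 2 →
           [ a ℕ.≟ 0 ] ℕ.+ ([ a ℕ.≟ 1 ] ℕ.+ ([ a ℕ.≟ 2 ] ℕ.+ 0)) ≡ 1
    once (inj₁ refl)        = refl
    once (inj₂ (inj₁ refl)) = refl
    once (inj₂ (inj₂ refl)) = refl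

    multiplicities : M 0 ≡ (q ∸ 1) / 2 × M 1 ≡ 1 × M 2 ≡ (q ∸ 1) / 2
    multiplicities with odd-halves total weighted
      where
      total : M 0 ℕ.+ (1 ℕ.+ M 2) ≡ q
      total = trans (cong₂ (λ m₁ m₂ → M 0 ℕ.+ (m₁ ℕ.+ m₂)) (sym M1≡1) (sym (ℕP.+-identityʳ (M 2))))
                    (occurrences-total N (0 ∷ᵛ 1 ∷ᵛ 2 ∷ᵛ []ᵛ) (once ∘ fibre-sizes 3≢0))
      weighted : 1 ℕ.+ 2 ℕ.* M 2 ≡ q
      weighted = trans (cong₂ ℕ._+_ (trans (sym M1≡1) (sym (ℕP.*-identityˡ (M 1)))) (sym (ℕP.+-identityʳ _)))
                       (trans (occurrences-weighted N (0 ∷ᵛ 1 ∷ᵛ 2 ∷ᵛ []ᵛ) (once ∘ fibre-sizes 3≢0)) ∑N≡q)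
    ... | M0≡ , M2≡ = M0≡ , M1≡1 , M2≡

  values-within : (zs : List ℕ) → length zs ≤ 3 → (∀ v → N v ∈ zs) → length (MultiplicityValues L 3) ≤ 3
  values-within zs |zs|≤3 N∈zs = ℕP.≤-trans
    (unique-length-≤ (deduplicate-! (map-list (N1 L 3) (allFin q)))
      (deduplicate⁺ ℕ._≟_ (map⁺ (tabulate⁺ (λ v → subst (_∈ zs) (sym (N1≡N v)) (N∈zs v))))))
    |zs|≤3

  multiplicity-values-≤3 : length (MultiplicityValues L 3) ≤ 3
  multiplicity-values-≤3 with three ≟ 0#
  ... | yes 3≡0 = values-within (0 ∷ q ∷ []) (ℕP.n≤1+n 2)
                    (λ v → [ here , there ∘ here ]′ (Characteristic3.fibre-0-or-q 3≡0 v))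
  ... | no 3≢0  = values-within (0 ∷ 1 ∷ 2 ∷ []) ℕP.≤-refl
                    (λ v → [ here , [ there ∘ here , there ∘ there ∘ here ]′ ]′ (fibre-sizes 3≢0 v))

-- The theorem: niceness is invertibility of 3 (the value bound always holds),
-- and the multiplicities are those computed for each characteristic.
mainTheorem3 : ∀ {q : ℕ} (L : FiniteField q) (p : ℕ) → IsCharacteristic L p →
    (Nice L 3 ⇔ (¬ (q % 3 ≡ 1)))
    × (¬ (q % 3 ≡ 1) →
        (p ≡ 2 → Multiplicity L 3 0 ≡ q / 2 × Multiplicity L 3 2 ≡ q / 2)
        × (p ≡ 3 → Multiplicity L 3 0 ≡ q ∸ 1 × Multiplicity L 3 q ≡ 1)
        × (p > 3 → Multiplicity L 3 0 ≡ (q ∸ 1) / 2 × Multiplicity L 3 1 ≡ 1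
                   × Multiplicity L 3 2 ≡ (q ∸ 1) / 2))
mainTheorem3 {zero}  L _ _ = contradiction (FiniteField.0# L) ¬Fin0
mainTheorem3 {suc m} L p (_ , p·1≡0 , p-least) = niceness , λ _ → char2 , char3 , large
  where
  open CubeSum L
  q = suc m

  niceness : Nice L 3 ⇔ (¬ q % 3 ≡ 1)
  niceness = mk⇔ (to (invertible-3⇔ m) ∘ proj₁)
                 (λ q≢1 → from (invertible-3⇔ m) q≢1 , multiplicity-values-≤3)

  char2 : p ≡ 2 → Multiplicity L 3 0 ≡ q / 2 × Multiplicity L 3 2 ≡ q / 2
  char2 refl = map-× (trans (Multiplicity≡M 0)) (trans (Multiplicity≡M 2))
    (Characteristic2.multiplicities (trans (sym 2×1≡two) p·1≡0))

  char3 : p ≡ 3 → Multiplicity L 3 0 ≡ q ∸ 1 × Multiplicity L 3 q ≡ 1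
  char3 refl = map-× (trans (Multiplicity≡M 0)) (trans (Multiplicity≡M q))
    (Characteristic3.multiplicities (trans (sym 3×1≡three) p·1≡0))

  large : p > 3 → Multiplicity L 3 0 ≡ (q ∸ 1) / 2 × Multiplicity L 3 1 ≡ 1 × Multiplicity L 3 2 ≡ (q ∸ 1) / 2
  large 3<p = map-× (trans (Multiplicity≡M 0)) (map-× (trans (Multiplicity≡M 1)) (trans (Multiplicity≡M 2)))
    (LargeCharacteristic.multiplicities
      (p-least 2 (s≤s z≤n) (ℕP.<-trans (ℕP.n<1+n 2) 3<p) ∘ trans 2×1≡two)
      (p-least 3 (s≤s z≤n) 3<p ∘ trans 3×1≡three))
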